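{- Let $G=(V,E)$ be a finite simple graph whose vertex set is partitioned into sets $V_1,\dots,V_t$ ($t$ a positive integer), each of which is a set of false twins, and let $m_i=|V_i|$ for $1\leq i\leq t$. Let $\Gamma$ be an Abelian group of order $m$ with $\sum_{i=1}^t m_i=m-1$. If $\Gamma^*$ can be partitioned into pairwise disjoint subsets $S_1,\dots,S_t$ with $|S_i|=m_i$ and $\sum_{s\in S_i}s=0$ for every $i$, then $G$ has a $\Gamma^*$-distance magic labeling.
   Context: $\Gamma$ is written additively and $\Gamma^*=\Gamma\setminus\{0\}$. A set of false twins in $G$ is a set of pairwise non-adjacent vertices all having the same (open) neighborhood $N(\cdot)$. A $\Gamma^*$-distance magic labeling of $G$ is a bijection $\ell\colon V\to\Gamma^*$ such that the weight $w(v)=\sum_{u\in N(v)}\ell(u)$ is the same for all $v\in V$. -}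

module Defs where

open import Level using (Level)
open import Data.Nat using (ℕ; _∸_; _≤_)
open import Data.Fin as Fin using (Fin)
open import Data.Bool using (Bool; true; false; if_then_else_)
open import Data.List using (List; foldr; map; allFin)
open import Data.Nat.ListAction using (sum)
open import Data.Product using (Σ; _×_; ∃-syntax)
open import Relation.Binary.PropositionalEquality using (_≡_; _≢_)
open import Relation.Nullary using (¬_; does)
open import Algebra.Bundles using (AbelianGroup)

record SimpleGraph (n : ℕ) : Set where
  field
    adj   : Fin n → Fin n → Bool
    sym   : ∀ u v → adj u v ≡ adj v u
    irrefl : ∀ v → adj v v ≡ false
open SimpleGraph public

count : ∀ {n} → (Fin n → Bool) → ℕ
count {n} p = sum (map (λ i → if p i then 1 else 0) (allFin n))

sumFin : ∀ {t} → (Fin t → ℕ) → ℕ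
sumFin {t} f = sum (map f (allFin t))

module _ {c ℓ : Level} (Γ : AbelianGroup c ℓ) where
  open AbelianGroup Γ

  gsumWhere : ∀ {k} → (Fin k → Bool) → (Fin k → Carrier) → Carrier
  gsumWhere {k} p f = foldr (λ i acc → (if p i then f i else ε) ∙ acc) ε (allFin k)

  HasOrder : ℕ → Set _
  HasOrder m = Σ (Fin m → Carrier) λ γ →
                 (∀ i j → γ i ≈ γ j → i ≡ j) × (∀ x → ∃[ i ] (γ i ≈ x))

  weight : ∀ {n} → SimpleGraph n → (Fin n → Carrier) → Fin n → Carrier
  weight G lab v = gsumWhere (adj G v) lab

  IsBijectionToΓ* : ∀ {n} → (Fin n → Carrier) → Set _
  IsBijectionToΓ* lab =
    (∀ u → ¬ (lab u ≈ ε)) ×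
    (∀ u v → lab u ≈ lab v → u ≡ v) ×
    (∀ x → ¬ (x ≈ ε) → ∃[ u ] (lab u ≈ x))

  -- Γ*-distance magic labeling of G
  -- Given an enumeration γ : Fin m → Γ, S : Fin t → Fin m → Bool describes
  -- subsets S_i = { γ k | S i k ≡ true } of Γ.
  IsZeroSumPartitionΓ* : ∀ {m t} → (Fin m → Carrier) → (Fin t → ℕ) →
                         (Fin t → Fin m → Bool) → Set _
  IsZeroSumPartitionΓ* {m} {t} γ sizes S =
    (∀ k → γ k ≈ ε → ∀ i → S i k ≡ false) ×
    (∀ k → ¬ (γ k ≈ ε) → ∃[ i ] (S i k ≡ true)) ×
    (∀ k i j → S i k ≡ true → S j k ≡ true → i ≡ j) ×
    (∀ i → count (S i) ≡ sizes i) ×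
    (∀ i → gsumWhere (S i) γ ≈ ε)

  IsDistanceMagic : ∀ {n} → SimpleGraph n → (Fin n → Carrier) → Set _
  IsDistanceMagic G lab =
    IsBijectionToΓ* lab × (∀ v v' → weight G lab v ≈ weight G lab v')

IsFalseTwinPartition : ∀ {n t} → SimpleGraph n → (Fin n → Fin t) → Set
IsFalseTwinPartition {n} {t} G cls =
  (∀ i → ∃[ v ] (cls v ≡ i)) ×
  (∀ u v → cls u ≡ cls v → adj G u v ≡ false) ×
  (∀ u v → cls u ≡ cls v → ∀ w → adj G u w ≡ adj G v w)

classSize : ∀ {n t} → (Fin n → Fin t) → Fin t → ℕ
classSize cls i = count (λ v → does (cls v Fin.≟ i))

-- Match each twin class V_i bijectively with the zero-sum set S_i (possible since
-- |V_i| = |S_i|) and label V_i by S_i. Every neighbourhood is a union of whole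
-- twin classes, so every weight is a sum of the zero sums over some S_i, hence 0.
module Submission where

open import Defs hiding (sym)
open import Level using (Level)
open import Data.Nat using (ℕ; zero; suc; _∸_; _≤_; _+_; _<_; z≤n; s≤s)
open import Data.Nat.Properties using (+-cancelˡ-≡; +-monoʳ-<)
open import Data.Fin using (Fin; zero; suc; _≟_)
open import Data.Bool using (Bool; true; false; if_then_else_)
open import Data.List using (foldr; tabulate)
open import Data.List.Properties using (map-tabulate)
open import Data.Nat.ListAction using () renaming (sum to sumℕ)
open import Data.Product using (_×_; _,_; proj₁; proj₂; ∃-syntax)
open import Data.Vec.Functional using (Vector)
open import Function using (_∘_)
open import Relation.Binary.PropositionalEquality as ≡ using (_≡_; subst)
open import Relation.Nullary using (¬_; does; yes; no; contradiction)
open import Relation.Nullary.Decidable using (dec-true)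
open import Algebra.Bundles using (CommutativeMonoid; AbelianGroup)
import Algebra.Properties.CommutativeMonoid.Sum as MonoidSum
import Relation.Binary.Reasoning.Setoid as SetoidReasoning

≟-sound : ∀ {n} (x y : Fin n) → does (x ≟ y) ≡ true → x ≡ y
≟-sound x y eq with x ≟ y
... | yes x≡y = x≡y

count-suc : ∀ {n} (q : Fin (suc n) → Bool) →
            count q ≡ (if q zero then 1 else 0) + count (q ∘ suc)
count-suc q = ≡.cong ((if q zero then 1 else 0) +_) (≡.cong sumℕ
  (≡.trans (map-tabulate suc indicator) (≡.sym (map-tabulate (λ i → i) (indicator ∘ suc)))))
  where
  indicator : Fin _ → ℕ
  indicator i = if q i then 1 else 0

rank : ∀ {n} → (Fin n → Bool) → Fin n → ℕ
rank q zero    = 0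
rank q (suc u) = (if q zero then 1 else 0) + rank (q ∘ suc) u

rank<count : ∀ {n} (q : Fin n → Bool) u → q u ≡ true → rank q u < count q
rank<count q zero    qu rewrite count-suc q | qu = s≤s z≤n
rank<count q (suc u) qu rewrite count-suc q = +-monoʳ-< _ (rank<count (q ∘ suc) u qu)

rank-injective : ∀ {n} (q : Fin n → Bool) u v → q u ≡ true → q v ≡ true →
                 rank q u ≡ rank q v → u ≡ v
rank-injective q zero    zero    _  _  _ = ≡.refl
rank-injective q zero    (suc v) qu _  r rewrite qu with () ← r
rank-injective q (suc u) zero    _  qv r rewrite qv with () ← r
rank-injective q (suc u) (suc v) qu qv r =
  ≡.cong suc (rank-injective (q ∘ suc) u v qu qv (+-cancelˡ-≡ _ _ _ r))

rank-surjective : ∀ {n} (q : Fin n → Bool) j → j < count q →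
                  ∃[ u ] (q u ≡ true × rank q u ≡ j)
rank-surjective {suc n} q j j<count rewrite count-suc q with q zero in q₀ | j | j<count
... | true  | zero  | _ = zero , q₀ , ≡.refl
... | true  | suc j | s≤s j<count′
  with u , qu , ≡.refl ← rank-surjective (q ∘ suc) j j<count′ =
  suc u , qu , ≡.cong (λ b → (if b then 1 else 0) + j) q₀
... | false | j     | j<count′
  with u , qu , ≡.refl ← rank-surjective (q ∘ suc) j j<count′ =
  suc u , qu , ≡.cong (λ b → (if b then 1 else 0) + j) q₀

module MaskedSum {c ℓ : Level} (M : CommutativeMonoid c ℓ) where
  open CommutativeMonoid M
  open MonoidSum M
  open SetoidReasoning setoid

  infixl 5 _when_

  _when_ : Carrier → Bool → Carrier
  x when b = if b then x else ε

  when-ε : ∀ {x} b → x ≈ ε → x when b ≈ ε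
  when-ε true  x≈ε = x≈ε
  when-ε false _   = refl

  ∑-when : ∀ {n} (f : Vector Carrier n) b → ∑[ i < n ] (f i when b) ≈ sum f when b
  ∑-when     f true  = refl
  ∑-when {n} f false = sum-replicate-zero n

  ∑≈ε : ∀ {n} {f : Vector Carrier n} → (∀ i → f i ≈ ε) → sum f ≈ ε
  ∑≈ε {n} f≈ε = trans (sum-cong-≋ f≈ε) (sum-replicate-zero n)

  ∑-δ : ∀ {n} (f : Vector Carrier n) j → ∑[ k < n ] (f k when does (j ≟ k)) ≈ f j
  ∑-δ {suc n} f zero    = trans (∙-congˡ (sum-replicate-zero n)) (identityʳ _)
  ∑-δ {suc n} f (suc j) = trans (identityˡ _) (∑-δ (f ∘ suc) j)

  ∑-partition : ∀ {n t} (cls : Fin n → Fin t) (f : Vector Carrier n) →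
                sum f ≈ ∑[ i < t ] ∑[ u < n ] (f u when does (cls u ≟ i))
  ∑-partition {n} {t} cls f = begin
    ∑[ u < n ] f u
      ≈⟨ sum-cong-≋ (λ u → sym (∑-δ (λ _ → f u) (cls u))) ⟩
    ∑[ u < n ] ∑[ i < t ] (f u when does (cls u ≟ i))
      ≈⟨ ∑-comm {n} {t} (λ u i → f u when does (cls u ≟ i)) ⟩
    ∑[ i < t ] ∑[ u < n ] (f u when does (cls u ≟ i)) ∎

  ∑-reindex : ∀ {n m} (p : Fin n → Bool) (q : Fin m → Bool) (φ : Fin n → Fin m)
              (g : Vector Carrier m) →
              (∀ u → p u ≡ true → q (φ u) ≡ true) →
              (∀ u v → p u ≡ true → p v ≡ true → φ u ≡ φ v → u ≡ v) →
              (∀ k → q k ≡ true → ∃[ u ] (p u ≡ true × φ u ≡ k)) →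
              ∑[ u < n ] (g (φ u) when p u) ≈ ∑[ k < m ] (g k when q k)
  ∑-reindex {n} {m} p q φ g p⇒q φ-injective φ-onto = begin
    ∑[ u < n ] (g (φ u) when p u)                                 ≈⟨ ∑-partition φ _ ⟩
    ∑[ k < m ] ∑[ u < n ] (g (φ u) when p u when does (φ u ≟ k)) ≈⟨ sum-cong-≋ fibre ⟩
    ∑[ k < m ] (g k when q k)                                     ∎
    where
    fibre : ∀ k → ∑[ u < n ] (g (φ u) when p u when does (φ u ≟ k)) ≈ g k when q k
    fibre k with q k in qk
    ... | false = ∑≈ε empty
      where
      empty : ∀ u → g (φ u) when p u when does (φ u ≟ k) ≈ ε
      empty u with φ u ≟ k
      ... | no _ = refl
      ... | yes ≡.refl with p u in pu
      ...   | false = refl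
      ...   | true  with () ← ≡.trans (≡.sym (p⇒q u pu)) qk
    ... | true with u₀ , pu₀ , ≡.refl ← φ-onto k qk =
      trans (sum-cong-≋ single) (∑-δ (λ _ → g (φ u₀)) u₀)
      where
      single : ∀ u → g (φ u) when p u when does (φ u ≟ φ u₀) ≈ g (φ u₀) when does (u₀ ≟ u)
      single u with u₀ ≟ u
      ... | yes ≡.refl rewrite dec-true (φ u₀ ≟ φ u₀) ≡.refl | pu₀ = refl
      ... | no u₀≢u with φ u ≟ φ u₀ | p u in pu
      ...   | no _       | _     = refl
      ...   | yes _      | false = refl
      ...   | yes φu≡φu₀ | true  = contradiction (φ-injective u₀ u pu₀ pu (≡.sym φu≡φu₀)) u₀≢u

module ClassMatching {n t m} (cls : Fin n → Fin t) (S : Fin t → Fin m → Bool)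
  (S-disjoint : ∀ k i j → S i k ≡ true → S j k ≡ true → i ≡ j)
  (|S|≡|V| : ∀ i → count (S i) ≡ classSize cls i) where

  inClass : Fin t → Fin n → Bool
  inClass i u = does (cls u ≟ i)

  inClass-cls : ∀ u → inClass (cls u) u ≡ true
  inClass-cls u = dec-true (cls u ≟ cls u) ≡.refl

  private
    match : ∀ u → ∃[ k ] (S (cls u) k ≡ true × rank (S (cls u)) k ≡ rank (inClass (cls u)) u)
    match u = rank-surjective (S (cls u)) _
      (subst (_ <_) (≡.sym (|S|≡|V| (cls u))) (rank<count _ u (inClass-cls u)))

  -- u is sent to the element of S (cls u) of the same rank as u has in its class.
  φ : Fin n → Fin m
  φ u = proj₁ (match u)

  φ-∈ : ∀ u → S (cls u) (φ u) ≡ true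
  φ-∈ u = proj₁ (proj₂ (match u))

  φ-rank : ∀ u → rank (S (cls u)) (φ u) ≡ rank (inClass (cls u)) u
  φ-rank u = proj₂ (proj₂ (match u))

  φ-injective : ∀ u v → φ u ≡ φ v → u ≡ v
  φ-injective u v φu≡φv =
    rank-injective (inClass (cls u)) u v
      (inClass-cls u) (dec-true (cls v ≟ cls u) (≡.sym same-class)) (begin
      rank (inClass (cls u)) u ≡⟨ ≡.sym (φ-rank u) ⟩
      rank (S (cls u)) (φ u)   ≡⟨ ≡.cong₂ (λ i k → rank (S i) k) same-class φu≡φv ⟩
      rank (S (cls v)) (φ v)   ≡⟨ φ-rank v ⟩
      rank (inClass (cls v)) v ≡⟨ ≡.cong (λ i → rank (inClass i) v) (≡.sym same-class) ⟩
      rank (inClass (cls u)) v ∎)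
    where
    open ≡.≡-Reasoning
    same-class : cls u ≡ cls v
    same-class = S-disjoint (φ u) (cls u) (cls v) (φ-∈ u)
                   (subst (λ k → S (cls v) k ≡ true) (≡.sym φu≡φv) (φ-∈ v))

  φ-onto : ∀ i k → S i k ≡ true → ∃[ u ] (cls u ≡ i × φ u ≡ k)
  φ-onto i k Sik
    with u , u∈Vi , rank-u ← rank-surjective (inClass i) (rank (S i) k)
                                (subst (_ <_) (|S|≡|V| i) (rank<count (S i) k Sik))
    with ≡.refl ← ≟-sound (cls u) i u∈Vi
    = u , ≡.refl , rank-injective (S (cls u)) (φ u) k (φ-∈ u) Sik (≡.trans (φ-rank u) rank-u)

module _ {c ℓ : Level} (Γ : AbelianGroup c ℓ) where
  open AbelianGroup Γ
  open MaskedSum commutativeMonoid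
  open MonoidSum commutativeMonoid using (sum-cong-≋; sum-syntax)
  open SetoidReasoning setoid

  gsumWhere≡∑ : ∀ {k} (p : Fin k → Bool) (f : Vector Carrier k) →
                gsumWhere Γ p f ≡ ∑[ i < k ] (f i when p i)
  gsumWhere≡∑ p f = foldr-tabulate (λ i → f i when p i) (λ i → i)
    where
    foldr-tabulate : ∀ {n k} (h : Vector Carrier k) (g : Fin n → Fin k) →
                     foldr (λ i acc → h i ∙ acc) ε (tabulate g) ≡ ∑[ j < n ] h (g j)
    foldr-tabulate {zero}  h g = ≡.refl
    foldr-tabulate {suc n} h g = ≡.cong (h (g zero) ∙_) (foldr-tabulate h (g ∘ suc))

  weight≈ε : ∀ {n t} (G : SimpleGraph n) (cls : Fin n → Fin t) →
             (∀ i → ∃[ v ] (cls v ≡ i)) →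
             (∀ u v → cls u ≡ cls v → ∀ w → adj G u w ≡ adj G v w) →
             (lab : Vector Carrier n) →
             (∀ i → ∑[ u < n ] (lab u when does (cls u ≟ i)) ≈ ε) →
             ∀ v → weight Γ G lab v ≈ ε
  weight≈ε {n} {t} G cls nonempty twins lab class-sum≈ε v = begin
    weight Γ G lab v                                                    ≡⟨ gsumWhere≡∑ (adj G v) lab ⟩
    ∑[ u < n ] (lab u when adj G v u)                                   ≈⟨ ∑-partition cls _ ⟩
    ∑[ i < t ] ∑[ u < n ] (lab u when adj G v u when does (cls u ≟ i)) ≈⟨ ∑≈ε class-term≈ε ⟩
    ε                                                                   ∎
    where
    adj-twin : ∀ {u w} → cls u ≡ cls w → adj G v u ≡ adj G v w
    adj-twin {u} {w} e =
      ≡.trans (SimpleGraph.sym G v u) (≡.trans (twins u w e v) (SimpleGraph.sym G w v))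

    class-term≈ε : ∀ i → ∑[ u < n ] (lab u when adj G v u when does (cls u ≟ i)) ≈ ε
    class-term≈ε i with w , ≡.refl ← nonempty i = begin
      ∑[ u < n ] (lab u when adj G v u when does (cls u ≟ cls w))
        ≈⟨ sum-cong-≋ regroup ⟩
      ∑[ u < n ] (lab u when does (cls u ≟ cls w) when adj G v w)
        ≈⟨ ∑-when (λ u → lab u when does (cls u ≟ cls w)) (adj G v w) ⟩
      ∑[ u < n ] (lab u when does (cls u ≟ cls w)) when adj G v w
        ≈⟨ when-ε (adj G v w) (class-sum≈ε (cls w)) ⟩
      ε ∎
      where
      regroup : ∀ u → lab u when adj G v u when does (cls u ≟ cls w)
                      ≈ lab u when does (cls u ≟ cls w) when adj G v w
      regroup u with cls u ≟ cls w
      ... | yes same-class = reflexive (≡.cong (lab u when_) (adj-twin same-class))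
      ... | no _           = sym (when-ε (adj G v w) refl)

module ZeroSumLabelling {c ℓ : Level} (Γ : AbelianGroup c ℓ) {n t m}
  (cls : Fin n → Fin t) (γ : Fin m → AbelianGroup.Carrier Γ) (S : Fin t → Fin m → Bool)
  (S-disjoint : ∀ k i j → S i k ≡ true → S j k ≡ true → i ≡ j)
  (|S|≡|V| : ∀ i → count (S i) ≡ classSize cls i) where
  open AbelianGroup Γ
  open MaskedSum commutativeMonoid
  open MonoidSum commutativeMonoid using (sum-syntax)
  open SetoidReasoning setoid
  open ClassMatching cls S S-disjoint |S|≡|V|

  label : Fin n → Carrier
  label = γ ∘ φ

  label-isBijection : (∀ k l → γ k ≈ γ l → k ≡ l) → (∀ x → ∃[ k ] (γ k ≈ x)) →
                      (∀ k → γ k ≈ ε → ∀ i → S i k ≡ false) →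
                      (∀ k → ¬ (γ k ≈ ε) → ∃[ i ] (S i k ≡ true)) →
                      IsBijectionToΓ* Γ label
  label-isBijection γ-injective γ-onto S∌ε S-cover = label≉ε , label-injective , label-onto
    where
    label≉ε : ∀ u → ¬ (label u ≈ ε)
    label≉ε u label≈ε with () ← ≡.trans (≡.sym (φ-∈ u)) (S∌ε (φ u) label≈ε (cls u))

    label-injective : ∀ u v → label u ≈ label v → u ≡ v
    label-injective u v labels≈ = φ-injective u v (γ-injective (φ u) (φ v) labels≈)

    label-onto : ∀ x → ¬ (x ≈ ε) → ∃[ u ] (label u ≈ x)
    label-onto x x≉ε
      with k , γk≈x ← γ-onto x
      with i , Sik ← S-cover k (λ γk≈ε → x≉ε (trans (sym γk≈x) γk≈ε))
      with u , _ , ≡.refl ← φ-onto i k Sik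
      = u , γk≈x

  class-sum≈ε : (∀ i → gsumWhere Γ (S i) γ ≈ ε) →
                ∀ i → ∑[ u < n ] (label u when inClass i u) ≈ ε
  class-sum≈ε ∑S≈ε i = begin
    ∑[ u < n ] (γ (φ u) when inClass i u)
      ≈⟨ ∑-reindex (inClass i) (S i) φ γ φ-∈Si (λ u v _ _ → φ-injective u v) φ-ontoVi ⟩
    ∑[ k < m ] (γ k when S i k)           ≡⟨ gsumWhere≡∑ Γ (S i) γ ⟨
    gsumWhere Γ (S i) γ                   ≈⟨ ∑S≈ε i ⟩
    ε                                     ∎
    where
    φ-∈Si : ∀ u → inClass i u ≡ true → S i (φ u) ≡ true
    φ-∈Si u u∈Vi = subst (λ j → S j (φ u) ≡ true) (≟-sound (cls u) i u∈Vi) (φ-∈ u)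

    φ-ontoVi : ∀ k → S i k ≡ true → ∃[ u ] (inClass i u ≡ true × φ u ≡ k)
    φ-ontoVi k Sik with u , cls-u≡i , φu≡k ← φ-onto i k Sik =
      u , dec-true (cls u ≟ i) cls-u≡i , φu≡k

proposition4p7 : ∀ {c ℓ : Level} (Γ : AbelianGroup c ℓ) (n t m : ℕ) → 1 ≤ t →
    (G : SimpleGraph n) (cls : Fin n → Fin t) → IsFalseTwinPartition G cls →
    (ord : HasOrder Γ m) → sumFin (classSize cls) ≡ m ∸ 1 →
    (∃[ S ] IsZeroSumPartitionΓ* Γ (proj₁ ord) (classSize cls) S) →
    ∃[ lab ] IsDistanceMagic Γ G lab
proposition4p7 Γ n t m _ G cls (nonempty , _ , twins) (γ , γ-injective , γ-onto) _
               (S , S∌ε , S-cover , S-disjoint , |S|≡|V| , ∑S≈ε) =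
  label , label-isBijection γ-injective γ-onto S∌ε S-cover ,
  λ v v′ → trans (weight-label≈ε v) (sym (weight-label≈ε v′))
  where
  open AbelianGroup Γ using (_≈_; ε; trans; sym)
  open ZeroSumLabelling Γ cls γ S S-disjoint |S|≡|V|

  weight-label≈ε : ∀ v → weight Γ G label v ≈ ε
  weight-label≈ε = weight≈ε Γ G cls nonempty twins label (class-sum≈ε ∑S≈ε)
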